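{- Let $E$ be a set of designs of the same base and let $V_E$ be the set of paths visitable in $E$. Then $V_E$ is positive-prefix closed: if $p\kappa^+w\in V_E$, where $\kappa^+$ is a positive action and $w$ a sequence of actions, then $p\kappa^+\in V_E$.
   Context: Ludics (Girard). Actions are proper actions $(\epsilon,\xi,I)$ (polarity $\epsilon\in\{+,-\}$, focus a locus $\xi$ = finite sequence of naturals, finite ramification $I$) or the positive daimon $\maltese$; $\overline{(\pm,\xi,I)}=(\mp,\xi,I)$. Designs are sets of chronicles (alternating, justified, linear sequences of actions) that are prefix-closed, pairwise coherent, positive-ended and total, as in Ludics; a net is a finite set of designs on disjoint bases. For a design $\mathfrak D$ on $\xi\vdash\sigma_1,\dots,\sigma_n$ (resp. $\vdash\sigma_1,\dots,\sigma_n$), a net $\mathfrak R$ on $\vdash\xi,\sigma_1\vdash,\dots,\sigma_n\vdash$ (resp. $\sigma_1\vdash,\dots,\sigma_n\vdash$) is orthogonal to $\mathfrak D$ if the normalization of $(\mathfrak D,\mathfrak R)$ converges: at each step, the first action of the unique positive-base (main) design is either $\maltese$ (convergence) or $(+,\sigma,I)$, which must be matched by a chronicle starting with $(-,\sigma,I)$ in the design having $\sigma$ as left locus (otherwise failure), both designs then being replaced by the subdesigns following these actions. $E^\perp$ is the set of nets orthogonal to all elements of $E$. For convergent $(\mathfrak D,\mathfrak R)$, the normalization path $\langle\mathfrak D\leftarrow\mathfrak R\rangle$ is the sequence of actions of $\mathfrak D$ visited during normalization: at each step the first action $\kappa$ of the main design is recorded if the main design comes from $\mathfrak D$, and $\overline\kappa$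 is recorded if it comes from $\mathfrak R$ and $\kappa\ne\maltese$. A path $p$ is visitable in $E$ if $p=\langle\mathfrak D\leftarrow\mathfrak R\rangle$ for some $\mathfrak D\in E$ and $\mathfrak R\in E^\perp$; $V_E$ is the set of such paths. -}

module Defs where

open import Level using (0ℓ)
open import Data.Nat using (ℕ; _<_)
open import Data.Nat.Properties using () renaming (_≟_ to _≟ℕ_)
open import Data.Fin using (Fin; zero; suc)
open import Data.List using (List; []; _∷_; _++_; _∷ʳ_; length; lookup; [_])
open import Data.Bool.ListAction using (any)
open import Data.List.Properties using (≡-dec)
open import Data.List.Membership.Propositional using (_∈_)
open import Data.List.Relation.Unary.Any using (Any)
open import Data.List.Relation.Unary.Linked using (Linked)
open import Data.List.Relation.Unary.AllPairs using (AllPairs)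
open import Data.Maybe using (Maybe; just; nothing)
open import Data.Bool using (Bool; true; false; if_then_else_)
open import Data.Product using (Σ; ∃; ∃₂; _×_; _,_)
open import Data.Sum using (_⊎_)
open import Data.Empty using (⊥)
open import Data.Unit.Polymorphic using (⊤)
open import Relation.Nullary using (¬_; Dec; yes; no; does)
open import Relation.Binary.PropositionalEquality using (_≡_; _≢_)

data Pol : Set where
  pos neg : Pol

opp : Pol → Pol
opp pos = neg
opp neg = pos

Locus : Set
Locus = List ℕ

_≟L_ : (x y : Locus) → Dec (x ≡ y)
_≟L_ = ≡-dec _≟ℕ_

-- proper action (ε, ξ, I) (the ramification I, a finite set of naturals,
-- is represented by a list; chronicles require it strictly increasing,
-- i.e. canonical) or the daimon
data Action : Set where
  daimon : Action
  prop   : Pol → Locus → List ℕ → Action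

pol : Action → Pol
pol daimon = pos
pol (prop ε _ _) = ε

dual : Action → Action
dual daimon = daimon
dual (prop ε ξ I) = prop (opp ε) ξ I

data Positive : Action → Set where
  pos-daimon : Positive daimon
  pos-prop   : ∀ {ξ I} → Positive (prop pos ξ I)

HasFocus : Locus → Action → Set
HasFocus ξ a = ∃₂ λ ε I → a ≡ prop ε ξ I

-- Bases  ξ ⊢ Λ  (left = just ξ)  or  ⊢ Λ  (left = nothing)

record Base : Set where
  constructor base
  field
    left  : Maybe Locus
    right : List Locus
open Base public

baseLoci : Base → List Locus
baseLoci (base nothing Λ) = Λ
baseLoci (base (just ξ) Λ) = ξ ∷ Λ

_⊑_ : {A : Set} → List A → List A → Set
u ⊑ v = ∃ λ w → v ≡ u ++ w

WFBase : Base → Set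
WFBase β = AllPairs (λ x y → ¬ (x ⊑ y) × ¬ (y ⊑ x)) (baseLoci β)

Initial : Maybe Locus → Action → Set
Initial (just ξ) a = ∃ λ I → a ≡ prop neg ξ I
Initial nothing a = pol a ≡ pos

record Chronicle (β : Base) (c : List Action) : Set where
  field
    nonempty    : c ≢ []
    initial     : ∀ a v → c ≡ a ∷ v → Initial (left β) a
    alternation : ∀ u a b v → c ≡ u ++ a ∷ b ∷ v → pol b ≡ opp (pol a)
    daimon-last : ∀ u v → c ≡ u ++ daimon ∷ v → v ≡ []
    ramification : ∀ u ε ξ I v → c ≡ u ++ prop ε ξ I ∷ v → Linked _<_ I
    justify-neg : ∀ u ξ I v → c ≡ u ++ prop neg ξ I ∷ v → u ≢ [] →
                  Σ (List Action) λ u' → Σ Locus λ ξ' → Σ (List ℕ) λ I' → Σ ℕ λ i →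
                    u ≡ u' ∷ʳ prop pos ξ' I' × i ∈ I' × ξ ≡ ξ' ∷ʳ i
    justify-pos : ∀ u ξ I v → c ≡ u ++ prop pos ξ I ∷ v →
                  ξ ∈ right β ⊎
                  (Σ (List Action) λ u₁ → Σ (List Action) λ u₂ → Σ Locus λ ξ' →
                   Σ (List ℕ) λ I' → Σ ℕ λ i →
                    u ≡ u₁ ++ prop neg ξ' I' ∷ u₂ × i ∈ I' × ξ ≡ ξ' ∷ʳ i)
    linear : ∀ u ε₁ ξ I₁ w ε₂ I₂ v → ¬ (c ≡ u ++ prop ε₁ ξ I₁ ∷ w ++ prop ε₂ ξ I₂ ∷ v)

Coherent : List Action → List Action → Set
Coherent c₁ c₂ =
  c₁ ⊑ c₂ ⊎ c₂ ⊑ c₁ ⊎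
  (Σ (List Action) λ w → Σ Action λ a₁ → Σ Action λ a₂ →
   Σ (List Action) λ v₁ → Σ (List Action) λ v₂ →
     c₁ ≡ w ++ a₁ ∷ v₁ × c₂ ≡ w ++ a₂ ∷ v₂ × a₁ ≢ a₂ ×
     pol a₁ ≡ neg × pol a₂ ≡ neg ×
     ((∀ ξ → HasFocus ξ a₁ → ¬ HasFocus ξ a₂) →
        ∀ ξ → Any (HasFocus ξ) (a₁ ∷ v₁) → ¬ Any (HasFocus ξ) (a₂ ∷ v₂)))

LastPositive : List Action → Set
LastPositive c = Σ (List Action) λ u → Σ Action λ a → c ≡ u ∷ʳ a × pol a ≡ pos

record Design (β : Base) : Set₁ where
  field
    mem           : List Action → Set
    chronicles    : ∀ c → mem c → Chronicle β c
    prefix-closed : ∀ c d → mem (c ++ d) → c ≢ [] → mem c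
    coherent      : ∀ c d → mem c → mem d → Coherent c d
    positive-ended : ∀ c → mem c → (∀ d → mem (c ++ d) → d ≡ []) → LastPositive c
    total         : left β ≡ nothing → Σ (List Action) mem
open Design public

-- Nets orthogonal to designs on β:
--   β = ξ ⊢ σ₁..σₙ  : a design on ⊢ ξ and designs on σᵢ ⊢
--   β = ⊢ σ₁..σₙ    : designs on σᵢ ⊢

PosPart : Maybe Locus → Set₁
PosPart nothing = ⊤
PosPart (just ξ) = Design (base nothing [ ξ ])

record Net (β : Base) : Set₁ where
  field
    posPart : PosPart (left β)
    negPart : (i : Fin (length (right β))) → Design (base (just (lookup (right β) i)) [])
open Net public

-- the designs of the cut-net (D, R)
data Who (n : ℕ) : Set where
  dD rPos : Who n
  rNeg : Fin n → Who n

posMem : (l : Maybe Locus) → PosPart l → List Action → Set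
posMem nothing _ _ = ⊥
posMem (just ξ) P c = mem P c

memW : {β : Base} → Design β → Net β → Who (length (right β)) → List Action → Set
memW D R dD = mem D
memW {β} D R rPos = posMem (left β) (posPart R)
memW D R (rNeg i) = mem (negPart R i)

-- The state consists of the main design
-- (the one whose next action is positive) with the chronicle prefix already
-- played in it, and a table assigning to each locus σ currently available
-- as a left locus the design owning it, together with the chronicle prefix
-- after which that design plays its negative action on σ.

Table : ℕ → Set
Table n = Locus → Maybe (Who n × List Action)

isChild : Locus → Locus → List ℕ → Bool
isChild τ σ I = any (λ i → does (τ ≟L (σ ∷ʳ i))) I

update : ∀ {n} → Table n → Locus → List ℕ → Who n → List Action → Table n
update t σ I m c τ with τ ≟L σ
... | yes _ = nothing
... | no _ = if isChild τ σ I then just (m , c) else t τ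

findIdx : Locus → (Λ : List Locus) → Maybe (Fin (length Λ))
findIdx τ [] = nothing
findIdx τ (σ ∷ Λ) with τ ≟L σ
... | yes _ = just zero
... | no _ with findIdx τ Λ
...   | just i = just (suc i)
...   | nothing = nothing

initNeg : (Λ : List Locus) → Table (length Λ)
initNeg Λ τ with findIdx τ Λ
... | just i = just (rNeg i , [])
... | nothing = nothing

initTable : (β : Base) → Table (length (right β))
initTable (base nothing Λ) = initNeg Λ
initTable (base (just ξ) Λ) τ with τ ≟L ξ
... | yes _ = just (dD , [])
... | no _ = initNeg Λ τ

initMain : (β : Base) → Who (length (right β))
initMain (base nothing Λ) = dD
initMain (base (just ξ) Λ) = rPos

-- recorded actions of D
recDaimon : ∀ {n} → Who n → List Action
recDaimon dD = [ daimon ]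
recDaimon _ = []

recProp : ∀ {n} → Who n → Locus → List ℕ → List Action
recProp dD σ I = [ prop pos σ I ]
recProp _ σ I = [ prop neg σ I ]

data NormPath {n : ℕ} (M : Who n → List Action → Set) :
              Who n → List Action → Table n → List Action → Set where
  conv : ∀ {m c t} → M m (c ∷ʳ daimon) → NormPath M m c t (recDaimon m)
  step : ∀ {m c t σ I j c' p} →
         M m (c ∷ʳ prop pos σ I) →
         t σ ≡ just (j , c') →
         M j (c' ∷ʳ prop neg σ I) →
         NormPath M j (c' ∷ʳ prop neg σ I) (update t σ I m (c ∷ʳ prop pos σ I)) p →
         NormPath M m c t (recProp m σ I ++ p)

NPath : {β : Base} → Design β → Net β → List Action → Set
NPath {β} D R p = NormPath (memW D R) (initMain β) [] (initTable β) p

Orthogonal : {β : Base} → Design β → Net β → Set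
Orthogonal D R = ∃ λ p → NPath D R p

Perp : {β : Base} → (Design β → Set) → Net β → Set₁
Perp {β} E R = (D : Design β) → E D → Orthogonal D R

Visitable : {β : Base} → (Design β → Set) → List Action → Set₁
Visitable {β} E p = Σ (Design β) λ D → E D × Σ (Net β) λ R → Perp E R × NPath D R p

-- Let D ∈ E and R ∈ E^⊥ visit p κ w with κ positive.  Actions recorded from D are D's own
-- positive actions or duals of R's positive actions, so κ is played by D: either κ = ✠, and
-- normalization stops right there, or κ = (+, σ, I) is answered by some design of R at a chronicle
-- x ending with (-, σ, I).  That design is not D itself, since σ is a positive locus for D whereas
-- every locus D answers on is negative (polarities alternate along the justification of loci).
-- Cutting that design at x, i.e. replacing everything beyond x by the daimon, gives a net R′ such
-- that D against R′ visits exactly p κ.  R′ is still in E^⊥: for any D′ ∈ E, normalization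
-- against R′ runs as against R until it reaches x, where it now converges at once.

module Submission where

open import Defs
open import Data.Nat using (ℕ; zero; suc; _<_; s≤s; z≤n)
open import Data.Nat.Induction using (<-wellFounded)
open import Data.Nat.Properties using () renaming (_≟_ to _≟ℕ_)
open import Data.Fin using (Fin) renaming (_≟_ to _≟ᶠ_)
open import Data.Maybe using (Maybe; just; nothing)
open import Data.Bool using (true; false)
open import Data.List using (List; []; _∷_; _++_; _∷ʳ_; [_]; length; lookup)
open import Data.List.Properties using (++-assoc; ++-identityʳ; ++-cancelˡ; ++-conicalˡ; ++-conicalʳ; ∷-injective; ∷-injectiveˡ; ∷-injectiveʳ; ∷ʳ-injective; ∷ʳ-injectiveʳ; ≡-dec)
open import Data.List.Membership.Propositional using (_∈_)
open import Data.List.Relation.Unary.Any using (Any; here; there)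
open import Data.List.Relation.Unary.Any.Properties using (++⁻; ++⁺ˡ; ++⁺ʳ)
open import Data.List.Relation.Unary.All as All using (All)
open import Data.List.Relation.Unary.AllPairs using (AllPairs; _∷_)
open import Data.Product using (Σ; ∃; _×_; _,_; proj₁; proj₂)
open import Data.Sum using (_⊎_; inj₁; inj₂) renaming ([_,_] to either)
open import Data.Empty using (⊥; ⊥-elim)
open import Induction.WellFounded using (Acc; acc)
open import Relation.Nullary using (¬_; Dec; yes; no)
open import Relation.Binary.Definitions using (DecidableEquality)
open import Relation.Binary.PropositionalEquality using (_≡_; _≢_; refl; sym; trans; cong; subst)

private variable
  A : Set

⊑-refl : (u : List A) → u ⊑ u
⊑-refl u = [] , sym (++-identityʳ u)

⊑-trans : {u v w : List A} → u ⊑ v → v ⊑ w → u ⊑ w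
⊑-trans {u = u} (a , refl) (b , refl) = a ++ b , ++-assoc u a b

u⊑u++v : (u v : List A) → u ⊑ (u ++ v)
u⊑u++v u v = v , refl

⊑-total-++ : (a b c d : List A) → a ++ b ≡ c ++ d → a ⊑ c ⊎ c ⊑ a
⊑-total-++ [] b c d eq = inj₁ (c , refl)
⊑-total-++ (x ∷ a) b [] d eq = inj₂ (x ∷ a , refl)
⊑-total-++ (x ∷ a) b (y ∷ c) d eq with ∷-injective eq
... | refl , eq′ with ⊑-total-++ a b c d eq′
...   | inj₁ (e , refl) = inj₁ (e , refl)
...   | inj₂ (e , refl) = inj₂ (e , refl)

∷ʳ≢[] : (u : List A) (a : A) → u ∷ʳ a ≢ []
∷ʳ≢[] u a eq with ++-conicalʳ u [ a ] eq
... | ()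

u≢u++a∷v : (u : List A) (a : A) (v : List A) → u ≢ u ++ a ∷ v
u≢u++a∷v u a v eq with ++-cancelˡ u (a ∷ v) [] (trans (sym eq) (sym (++-identityʳ u)))
... | ()

++∷≡∷ʳ-split : (u : List A) (a : A) (v x : List A) (z : A) → u ++ a ∷ v ≡ x ∷ʳ z →
               (v ≡ [] × a ≡ z × u ≡ x) ⊎ (Σ (List A) λ v′ → v ≡ v′ ∷ʳ z × x ≡ u ++ a ∷ v′)
++∷≡∷ʳ-split [] a v [] z refl = inj₁ (refl , refl , refl)
++∷≡∷ʳ-split [] a v (y ∷ x) z refl = inj₂ (x , refl , refl)
++∷≡∷ʳ-split (b ∷ u) a v [] z eq with ++-conicalʳ u (a ∷ v) (∷-injectiveʳ eq)
... | ()
++∷≡∷ʳ-split (b ∷ u) a v (y ∷ x) z eq with ∷-injective eq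
... | refl , eq′ with ++∷≡∷ʳ-split u a v x z eq′
...   | inj₁ (p , q , refl) = inj₁ (p , q , refl)
...   | inj₂ (v′ , p , refl) = inj₂ (v′ , p , refl)

⊑-∷ʳ : (x c : List A) (a : A) → x ⊑ (c ∷ʳ a) → x ⊑ c ⊎ x ≡ c ∷ʳ a
⊑-∷ʳ x c a (e , eq) with ⊑-total-++ c [ a ] x e eq
... | inj₂ x⊑c = inj₁ x⊑c
... | inj₁ ([] , refl) = inj₁ ([] , sym (trans (++-identityʳ (c ++ [])) (++-identityʳ c)))
... | inj₁ (a′ ∷ f , refl)
      with ∷-injective (++-cancelˡ c [ a ] (a′ ∷ f ++ e) (trans eq (++-assoc c (a′ ∷ f) e)))
...   | refl , []≡f++e with ++-conicalˡ f e (sym []≡f++e)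
...     | refl = inj₂ refl

++∷≢[] : (p : List A) (κ : A) (w : List A) → p ++ κ ∷ w ≢ []
++∷≢[] p κ w eq with ++-conicalʳ p (κ ∷ w) eq
... | ()

length-<-++∷ : (u : List A) (a : A) (v : List A) → length u < length (u ++ a ∷ v)
length-<-++∷ [] a v = s≤s z≤n
length-<-++∷ (_ ∷ u) a v = s≤s (length-<-++∷ u a v)

⊑-∷ʳ-irrefl : (u : List A) (a : A) → ¬ (u ∷ʳ a) ⊑ u
⊑-∷ʳ-irrefl u a (e , eq) = u≢u++a∷v u a e (trans eq (++-assoc u [ a ] e))

infix 4 _⊏_

_⊏_ : List A → List A → Set
x ⊏ d = Σ _ λ b → Σ (List _) λ w → d ≡ x ++ b ∷ w

⊏-irrefl : (x : List A) → ¬ x ⊏ x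
⊏-irrefl x (b , w , eq) = u≢u++a∷v x b w eq

⊏-++ : {x c : List A} (d : List A) → x ⊏ c → x ⊏ c ++ d
⊏-++ {x = x} d (b , w , refl) = b , w ++ d , ++-assoc x (b ∷ w) d

⊏-∷ʳ⇒⊑ : (x c : List A) (a : A) → x ⊏ c ∷ʳ a → x ⊑ c
⊏-∷ʳ⇒⊑ x c a (b , w , eq) with ++∷≡∷ʳ-split x b w c a (sym eq)
... | inj₁ (_ , _ , refl) = ⊑-refl x
... | inj₂ (w′ , _ , refl) = b ∷ w′ , refl

⊏-dec : DecidableEquality A → (x d : List A) → Dec (x ⊏ d)
⊏-dec _≟_ [] [] = no λ ()
⊏-dec _≟_ [] (b ∷ w) = yes (b , w , refl)
⊏-dec _≟_ (a ∷ x) [] = no λ ()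
⊏-dec _≟_ (a ∷ x) (b ∷ d) with a ≟ b | ⊏-dec _≟_ x d
... | yes refl | yes (b′ , w , refl) = yes (b′ , w , refl)
... | yes refl | no x⋤d = no λ (b′ , w , eq) → x⋤d (b′ , w , ∷-injectiveʳ eq)
... | no a≢b | _ = no λ (_ , _ , eq) → a≢b (sym (∷-injectiveˡ eq))

_≟ᴾ_ : DecidableEquality Pol
pos ≟ᴾ pos = yes refl
pos ≟ᴾ neg = no λ ()
neg ≟ᴾ pos = no λ ()
neg ≟ᴾ neg = yes refl

_≟ᴬ_ : DecidableEquality Action
daimon ≟ᴬ daimon = yes refl
daimon ≟ᴬ prop _ _ _ = no λ ()
prop _ _ _ ≟ᴬ daimon = no λ ()
prop ε ξ I ≟ᴬ prop ε′ ξ′ I′ with ε ≟ᴾ ε′ | ξ ≟L ξ′ | ≡-dec _≟ℕ_ I I′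
... | yes refl | yes refl | yes refl = yes refl
... | no ε≢ε′ | _ | _ = no λ { refl → ε≢ε′ refl }
... | yes _ | no ξ≢ξ′ | _ = no λ { refl → ξ≢ξ′ refl }
... | yes _ | yes _ | no I≢I′ = no λ { refl → I≢I′ refl }

_≟ᵂ_ : ∀ {n} → DecidableEquality (Who n)
dD ≟ᵂ dD = yes refl
dD ≟ᵂ rPos = no λ ()
dD ≟ᵂ rNeg _ = no λ ()
rPos ≟ᵂ dD = no λ ()
rPos ≟ᵂ rPos = yes refl
rPos ≟ᵂ rNeg _ = no λ ()
rNeg _ ≟ᵂ dD = no λ ()
rNeg _ ≟ᵂ rPos = no λ ()
rNeg i ≟ᵂ rNeg i′ with i ≟ᶠ i′
... | yes refl = yes refl
... | no i≢i′ = no λ { refl → i≢i′ refl }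

oppⁿ : ℕ → Pol → Pol
oppⁿ zero ε = ε
oppⁿ (suc n) ε = opp (oppⁿ n ε)

oppⁿ-∷ʳ : (k : List ℕ) (i : ℕ) (ε : Pol) → oppⁿ (length (k ∷ʳ i)) ε ≡ opp (oppⁿ (length k) ε)
oppⁿ-∷ʳ [] i ε = refl
oppⁿ-∷ʳ (_ ∷ k) i ε = cong opp (oppⁿ-∷ʳ k i ε)

-- Actions of a design on β focused on τ have polarity ε: positive at even distance from a right
-- locus, negative at even distance from the left locus.
PolarityAt : Base → Locus → Pol → Set
PolarityAt β τ ε =
    (Σ Locus λ λ₀ → λ₀ ∈ right β × Σ (List ℕ) λ k → τ ≡ λ₀ ++ k × oppⁿ (length k) pos ≡ ε)
  ⊎ (Σ Locus λ ξ → left β ≡ just ξ × Σ (List ℕ) λ k → τ ≡ ξ ++ k × oppⁿ (length k) neg ≡ ε)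

polarityAt-∷ʳ : ∀ {β τ ε} (i : ℕ) → PolarityAt β τ ε → PolarityAt β (τ ∷ʳ i) (opp ε)
polarityAt-∷ʳ i (inj₁ (λ₀ , λ₀∈ , k , refl , e)) =
  inj₁ (λ₀ , λ₀∈ , k ∷ʳ i , ++-assoc λ₀ k [ i ] , trans (oppⁿ-∷ʳ k i pos) (cong opp e))
polarityAt-∷ʳ i (inj₂ (ξ , l≡ξ , k , refl , e)) =
  inj₂ (ξ , l≡ξ , k ∷ʳ i , ++-assoc ξ k [ i ] , trans (oppⁿ-∷ʳ k i neg) (cong opp e))

Disjoint : Locus → Locus → Set
Disjoint x y = ¬ x ⊑ y × ¬ y ⊑ x

disjoint-⊑⇒≡ : ∀ {xs x y} → AllPairs Disjoint xs → x ∈ xs → y ∈ xs → x ⊑ y ⊎ y ⊑ x → x ≡ y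
disjoint-⊑⇒≡ (_ ∷ _) (here refl) (here refl) _ = refl
disjoint-⊑⇒≡ (x# ∷ _) (here refl) (there y∈) (inj₁ x⊑y) = ⊥-elim (proj₁ (All.lookup x# y∈) x⊑y)
disjoint-⊑⇒≡ (x# ∷ _) (here refl) (there y∈) (inj₂ y⊑x) = ⊥-elim (proj₂ (All.lookup x# y∈) y⊑x)
disjoint-⊑⇒≡ (y# ∷ _) (there x∈) (here refl) (inj₁ x⊑y) = ⊥-elim (proj₂ (All.lookup y# x∈) x⊑y)
disjoint-⊑⇒≡ (y# ∷ _) (there x∈) (here refl) (inj₂ y⊑x) = ⊥-elim (proj₁ (All.lookup y# x∈) y⊑x)
disjoint-⊑⇒≡ (_ ∷ xs#) (there x∈) (there y∈) cmp = disjoint-⊑⇒≡ xs# x∈ y∈ cmp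

WFBase⇒disjoint-right : ∀ β → WFBase β → AllPairs Disjoint (right β)
WFBase⇒disjoint-right (base nothing Λ) wf = wf
WFBase⇒disjoint-right (base (just ξ) Λ) (_ ∷ wf) = wf

pos≢neg : pos ≢ neg
pos≢neg ()

polarityAt-unique : ∀ β τ → WFBase β → PolarityAt β τ pos → PolarityAt β τ neg → ⊥
polarityAt-unique β τ wf (inj₁ (λ₀ , λ₀∈ , k , refl , e)) (inj₁ (λ₁ , λ₁∈ , k′ , eq , e′))
  with disjoint-⊑⇒≡ (WFBase⇒disjoint-right β wf) λ₀∈ λ₁∈ (⊑-total-++ λ₀ k λ₁ k′ eq)
... | refl with ++-cancelˡ λ₀ k k′ eq
...   | refl = pos≢neg (trans (sym e) e′)
polarityAt-unique (base (just ξ) Λ) τ (ξ# ∷ _)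
                  (inj₁ (λ₀ , λ₀∈ , k , refl , _)) (inj₂ (_ , refl , k′ , eq , _))
  with ⊑-total-++ λ₀ k ξ k′ eq
... | inj₁ λ₀⊑ξ = proj₂ (All.lookup ξ# λ₀∈) λ₀⊑ξ
... | inj₂ ξ⊑λ₀ = proj₁ (All.lookup ξ# λ₀∈) ξ⊑λ₀
polarityAt-unique (base (just ξ) Λ) τ (ξ# ∷ _)
                  (inj₂ (_ , refl , k , refl , _)) (inj₁ (λ₀ , λ₀∈ , k′ , eq , _))
  with ⊑-total-++ ξ k λ₀ k′ eq
... | inj₁ ξ⊑λ₀ = proj₁ (All.lookup ξ# λ₀∈) ξ⊑λ₀
... | inj₂ λ₀⊑ξ = proj₂ (All.lookup ξ# λ₀∈) λ₀⊑ξ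
polarityAt-unique (base (just ξ) Λ) τ _ (inj₂ (_ , refl , k , refl , e)) (inj₂ (_ , refl , k′ , eq , e′))
  with ++-cancelˡ ξ k k′ eq
... | refl = pos≢neg (trans (sym e) e′)

polarityAt-focus : ∀ {β c} → Chronicle β c → ∀ u ε σ I v → c ≡ u ++ prop ε σ I ∷ v → PolarityAt β σ ε
polarityAt-focus {β} {c} ch u ε σ I v eq = go u (<-wellFounded (length u)) ε σ I v eq
  where
  open Chronicle ch
  go : ∀ u → Acc _<_ (length u) → ∀ ε σ I v → c ≡ u ++ prop ε σ I ∷ v → PolarityAt β σ ε
  go u (acc rec) pos σ I v eq with justify-pos u σ I v eq
  ... | inj₁ σ∈ = inj₁ (σ , σ∈ , [] , sym (++-identityʳ σ) , refl)
  ... | inj₂ (u₁ , u₂ , ξ′ , I′ , i , refl , _ , refl) =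
        polarityAt-∷ʳ i (go u₁ (rec (length-<-++∷ u₁ _ u₂)) neg ξ′ I′ (u₂ ++ prop pos (ξ′ ∷ʳ i) I ∷ v)
          (trans eq (++-assoc u₁ (prop neg ξ′ I′ ∷ u₂) _)))
  go [] _ neg σ I v eq with left β | initial _ v eq
  ... | just ξ | I′ , refl = inj₂ (ξ , refl , [] , sym (++-identityʳ ξ) , refl)
  go (a ∷ u) (acc rec) neg σ I v eq with justify-neg (a ∷ u) σ I v eq (λ ())
  ... | u′ , ξ′ , I′ , i , u≡ , _ , refl =
        polarityAt-∷ʳ i (go u′ (rec (subst (λ z → length u′ < length z) (sym u≡) (length-<-++∷ u′ _ [])))
          pos ξ′ I′ (prop neg (ξ′ ∷ʳ i) I ∷ v)
          (trans eq (trans (cong (_++ _) u≡) (++-assoc u′ [ prop pos ξ′ I′ ] _))))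

module Truncation {β : Base} (D : Design β) (c : List Action) (σ : Locus) (I : List ℕ)
                  (x∈D : mem D (c ∷ʳ prop neg σ I)) where

  x : List Action
  x = c ∷ʳ prop neg σ I

  private
    module X = Chronicle (chronicles D x x∈D)

    last-of-x : ∀ u a → x ≡ u ∷ʳ a → a ≡ prop neg σ I
    last-of-x u a eq = sym (proj₂ (∷ʳ-injective c u eq))

    inside-x : ∀ u a v → x ∷ʳ daimon ≡ u ++ a ∷ v → a ≢ daimon →
               Σ (List Action) λ v′ → v ≡ v′ ∷ʳ daimon × x ≡ u ++ a ∷ v′
    inside-x u a v eq a≢✠ with ++∷≡∷ʳ-split u a v x daimon (sym eq)
    ... | inj₁ (_ , a≡✠ , _) = ⊥-elim (a≢✠ a≡✠)
    ... | inj₂ r = r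

    x✠-chronicle : Chronicle β (x ∷ʳ daimon)
    x✠-chronicle = record
      { nonempty = ∷ʳ≢[] x daimon
      ; initial = initial
      ; alternation = alternation
      ; daimon-last = daimon-last
      ; ramification = λ u ε ξ J v eq →
          let (v′ , _ , e) = inside-x u _ v eq (λ ()) in X.ramification u ε ξ J v′ e
      ; justify-neg = λ u ξ J v eq u≢[] →
          let (v′ , _ , e) = inside-x u _ v eq (λ ()) in X.justify-neg u ξ J v′ e u≢[]
      ; justify-pos = λ u ξ J v eq →
          let (v′ , _ , e) = inside-x u _ v eq (λ ()) in X.justify-pos u ξ J v′ e
      ; linear = linear
      }
      where
      initial : ∀ a v → x ∷ʳ daimon ≡ a ∷ v → Initial (left β) a
      initial a v eq with ++∷≡∷ʳ-split [] a v x daimon (sym eq)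
      ... | inj₁ (_ , _ , []≡x) = ⊥-elim (X.nonempty (sym []≡x))
      ... | inj₂ (v′ , _ , e) = X.initial a v′ e
      alternation : ∀ u a b v → x ∷ʳ daimon ≡ u ++ a ∷ b ∷ v → pol b ≡ opp (pol a)
      alternation u a b v eq with ++∷≡∷ʳ-split u a (b ∷ v) x daimon (sym eq)
      ... | inj₂ ([] , e₁ , e₂) with ∷-injective e₁ | last-of-x u a e₂
      ...   | refl , _ | refl = refl
      alternation u a b v eq | inj₂ (b′ ∷ v′ , e₁ , e₂) with ∷-injective e₁
      ...   | refl , _ = X.alternation u a b v′ e₂
      daimon-last : ∀ u v → x ∷ʳ daimon ≡ u ++ daimon ∷ v → v ≡ []
      daimon-last u v eq with ++∷≡∷ʳ-split u daimon v x daimon (sym eq)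
      ... | inj₁ (v≡[] , _ , _) = v≡[]
      ... | inj₂ (v′ , _ , e) with X.daimon-last u v′ e
      ...   | refl with last-of-x u daimon e
      ...     | ()
      linear : ∀ u ε₁ ξ I₁ w ε₂ I₂ v → ¬ (x ∷ʳ daimon ≡ u ++ prop ε₁ ξ I₁ ∷ w ++ prop ε₂ ξ I₂ ∷ v)
      linear u ε₁ ξ I₁ w ε₂ I₂ v eq with inside-x u _ _ eq (λ ())
      ... | v′ , e₁ , e₂ with ++∷≡∷ʳ-split w (prop ε₂ ξ I₂) v v′ daimon e₁
      ...   | inj₂ (v″ , _ , refl) = X.linear u ε₁ ξ I₁ w ε₂ I₂ v″ e₂

  Mem : List Action → Set
  Mem d = (mem D d × ¬ x ⊏ d) ⊎ d ≡ x ∷ʳ daimon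

  private
    coherent-x✠ : ∀ d → mem D d → ¬ x ⊏ d → Coherent d (x ∷ʳ daimon)
    coherent-x✠ d d∈D x⋤d with coherent D d x d∈D x∈D
    ... | inj₁ d⊑x = inj₁ (⊑-trans d⊑x (u⊑u++v x [ daimon ]))
    ... | inj₂ (inj₁ ([] , refl)) = inj₁ ([ daimon ] , cong (_++ [ daimon ]) (sym (++-identityʳ x)))
    ... | inj₂ (inj₁ (b ∷ e , eq)) = ⊥-elim (x⋤d (b , e , eq))
    ... | inj₂ (inj₂ (w , a₁ , a₂ , v₁ , v₂ , e₁ , e₂ , a₁≢a₂ , p₁ , p₂ , propagate)) =
          inj₂ (inj₂ (w , a₁ , a₂ , v₁ , v₂ ∷ʳ daimon , e₁ ,
            trans (cong (_++ [ daimon ]) e₂) (++-assoc w (a₂ ∷ v₂) [ daimon ]) , a₁≢a₂ , p₁ , p₂ ,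
            λ fresh ξ in₁ in₂ → either (propagate fresh ξ in₁) no-focus (++⁻ (a₂ ∷ v₂) in₂)))
      where
      no-focus : ∀ {ξ} → ¬ Any (HasFocus ξ) [ daimon ]
      no-focus (here (_ , _ , ()))

    coherent-sym : ∀ c d → Coherent c d → Coherent d c
    coherent-sym c d (inj₁ c⊑d) = inj₂ (inj₁ c⊑d)
    coherent-sym c d (inj₂ (inj₁ d⊑c)) = inj₁ d⊑c
    coherent-sym c d (inj₂ (inj₂ (w , a₁ , a₂ , v₁ , v₂ , e₁ , e₂ , a₁≢a₂ , p₁ , p₂ , propagate))) =
      inj₂ (inj₂ (w , a₂ , a₁ , v₂ , v₁ , e₂ , e₁ , (λ e → a₁≢a₂ (sym e)) , p₂ , p₁ ,
        λ fresh ξ in₂ in₁ → propagate (λ τ f₁ f₂ → fresh τ f₂ f₁) ξ in₁ in₂))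

    prefix-closed-Mem : ∀ d e → Mem (d ++ e) → d ≢ [] → Mem d
    prefix-closed-Mem d e (inj₁ (de∈D , x⋤de)) d≢[] =
      inj₁ (prefix-closed D d e de∈D d≢[] , λ x⊏d → x⋤de (⊏-++ e x⊏d))
    prefix-closed-Mem d [] (inj₂ eq) _ = inj₂ (trans (sym (++-identityʳ d)) eq)
    prefix-closed-Mem d (a ∷ e) (inj₂ eq) d≢[] with ++∷≡∷ʳ-split d a e x daimon eq
    ... | inj₁ (_ , _ , refl) = inj₁ (x∈D , ⊏-irrefl x)
    ... | inj₂ (e′ , _ , x≡) =
          inj₁ (prefix-closed D d (a ∷ e′) (subst (mem D) x≡ x∈D) d≢[] ,
                λ { (b , w , refl) → u≢u++a∷v x b (w ++ a ∷ e′) (trans x≡ (++-assoc x (b ∷ w) (a ∷ e′))) })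

    coherent-Mem : ∀ d e → Mem d → Mem e → Coherent d e
    coherent-Mem d e (inj₁ (d∈D , _)) (inj₁ (e∈D , _)) = coherent D d e d∈D e∈D
    coherent-Mem d _ (inj₁ (d∈D , x⋤d)) (inj₂ refl) = coherent-x✠ d d∈D x⋤d
    coherent-Mem _ e (inj₂ refl) (inj₁ (e∈D , x⋤e)) = coherent-sym e _ (coherent-x✠ e e∈D x⋤e)
    coherent-Mem _ _ (inj₂ refl) (inj₂ refl) = inj₁ (⊑-refl _)

    -- A maximal chronicle of the truncation that is kept from D is maximal in D: any extension
    -- in D reaching beyond x would make x ∷ʳ ✠ extend it.
    positive-ended-Mem : ∀ d → Mem d → (∀ e → Mem (d ++ e) → e ≡ []) → LastPositive d
    positive-ended-Mem _ (inj₂ refl) _ = x , daimon , refl , refl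
    positive-ended-Mem d (inj₁ (d∈D , x⋤d)) maximal = positive-ended D d d∈D maximal-in-D
      where
      maximal-in-D : ∀ e → mem D (d ++ e) → e ≡ []
      maximal-in-D e de∈D with ⊏-dec _≟ᴬ_ x (d ++ e)
      ... | no x⋤de = maximal e (inj₁ (de∈D , x⋤de))
      ... | yes (b , w , eq) with ⊑-total-++ d e x (b ∷ w) eq
      ...   | inj₂ (b′ ∷ w′ , refl) = ⊥-elim (x⋤d (b′ , w′ , refl))
      ...   | inj₂ ([] , refl) with maximal [ daimon ] (inj₂ (cong (_∷ʳ daimon) (++-identityʳ x)))
      ...     | ()
      maximal-in-D e de∈D | yes (b , w , eq) | inj₁ (f , x≡df)
            with maximal (f ∷ʳ daimon)
                   (inj₂ (trans (sym (++-assoc d f [ daimon ])) (cong (_∷ʳ daimon) (sym x≡df))))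
      ... | f✠≡[] = ⊥-elim (∷ʳ≢[] f daimon f✠≡[])

  truncated : Design β
  truncated = record
    { mem = Mem
    ; chronicles = λ { d (inj₁ (d∈D , _)) → chronicles D d d∈D ; _ (inj₂ refl) → x✠-chronicle }
    ; prefix-closed = prefix-closed-Mem
    ; coherent = coherent-Mem
    ; positive-ended = positive-ended-Mem
    ; total = λ _ → x ∷ʳ daimon , inj₂ refl
    }

isChild⇒∷ʳ : ∀ τ σ (I : List ℕ) → isChild τ σ I ≡ true → Σ ℕ λ i → τ ≡ σ ∷ʳ i
isChild⇒∷ʳ τ σ (i ∷ I) h with τ ≟L (σ ∷ʳ i)
... | yes τ≡σi = i , τ≡σi
... | no _ = isChild⇒∷ʳ τ σ I h

update-just : ∀ {n} (t : Table n) σ I m c τ e → update t σ I m c τ ≡ just e →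
              τ ≢ σ × (((Σ ℕ λ i → τ ≡ σ ∷ʳ i) × e ≡ (m , c)) ⊎ t τ ≡ just e)
update-just t σ I m c τ e h with τ ≟L σ
update-just t σ I m c τ e () | yes _
... | no τ≢σ with isChild τ σ I in child
...   | true with h
...     | refl = τ≢σ , inj₁ (isChild⇒∷ʳ τ σ I child , refl)
update-just t σ I m c τ e h | no τ≢σ | false = τ≢σ , inj₂ h

findIdx-just : ∀ τ (Λ : List Locus) i → findIdx τ Λ ≡ just i → τ ∈ Λ
findIdx-just τ (σ ∷ Λ) i h with τ ≟L σ
... | yes τ≡σ = here τ≡σ
... | no _ with findIdx τ Λ in found
...   | just i′ = there (findIdx-just τ Λ i′ found)

initNeg-just : ∀ Λ τ w c₀ → initNeg Λ τ ≡ just (w , c₀) → τ ∈ Λ × c₀ ≡ [] × w ≢ dD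
initNeg-just Λ τ w c₀ h with findIdx τ Λ in found
initNeg-just Λ τ w c₀ refl | just i = findIdx-just τ Λ i found , refl , λ ()

initTable-just : ∀ β τ w c₀ → initTable β τ ≡ just (w , c₀) →
                 τ ∈ baseLoci β × c₀ ≡ [] × (w ≡ dD → left β ≡ just τ)
initTable-just (base nothing Λ) τ w c₀ h with initNeg-just Λ τ w c₀ h
... | τ∈ , c₀≡[] , w≢dD = τ∈ , c₀≡[] , λ w≡dD → ⊥-elim (w≢dD w≡dD)
initTable-just (base (just ξ) Λ) τ w c₀ h with τ ≟L ξ
initTable-just (base (just ξ) Λ) τ w c₀ refl | yes refl = here refl , refl , λ _ → refl
... | no _ with initNeg-just Λ τ w c₀ h
...   | τ∈ , c₀≡[] , w≢dD = there τ∈ , c₀≡[] , λ w≡dD → ⊥-elim (w≢dD w≡dD)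

FociIn : List Locus → List Action → Set
FociIn U d = ∀ τ → Any (HasFocus τ) d → τ ∈ U

FociIn-∷ʳ : ∀ {U c} ε σ I → FociIn U c → FociIn (σ ∷ U) (c ∷ʳ prop ε σ I)
FociIn-∷ʳ {c = c} ε σ I foci τ τ∈ with ++⁻ c τ∈
... | inj₁ τ∈c = there (foci τ τ∈c)
... | inj₂ (here (_ , _ , refl)) = here refl

∷ʳ-⊑⇒≡ : ∀ (σ : Locus) i i′ → (σ ∷ʳ i) ⊑ (σ ∷ʳ i′) → σ ∷ʳ i ≡ σ ∷ʳ i′
∷ʳ-⊑⇒≡ σ i i′ (e , eq) with ++-cancelˡ σ [ i′ ] (i ∷ e) (trans eq (++-assoc σ [ i ] e))
... | refl = refl

recDaimon-opponent : ∀ {n} (j : Who n) → j ≢ dD → recDaimon j ≡ []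
recDaimon-opponent dD j≢dD = ⊥-elim (j≢dD refl)
recDaimon-opponent rPos _ = refl
recDaimon-opponent (rNeg i) _ = refl

recProp-++-∷ : ∀ {n} (m : Who n) σ I q a r → recProp m σ I ++ q ≡ a ∷ r → recProp m σ I ≡ [ a ] × q ≡ r
recProp-++-∷ dD σ I q a r refl = refl , refl
recProp-++-∷ rPos σ I q a r refl = refl , refl
recProp-++-∷ (rNeg i) σ I q a r refl = refl , refl

AgreeOutside : {W : Set} → W → List Action → (W → List Action → Set) → (W → List Action → Set) → Set
AgreeOutside j x M M′ = ∀ w d → M w d → ¬ (w ≡ j × x ⊏ d) → M′ w d

⊏-HasFocus : ∀ c σ I d → (c ∷ʳ prop neg σ I) ⊏ d → Any (HasFocus σ) d
⊏-HasFocus c σ I d (b , w , refl) = ++⁺ˡ (++⁺ʳ c (here (neg , I , refl)))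

module Visit {β : Base} (wf : WFBase β) (D : Design β) (R : Net β) where

  private
    n = length (right β)
    M = memW D R

  -- U collects the foci visited so far.
  record Invariant (U : List Locus) (c : List Action) (t : Table n) : Set where
    field
      table-fresh     : ∀ τ e → t τ ≡ just e → ∀ u → u ∈ U → ¬ τ ⊑ u
      table-antichain : ∀ τ τ′ e e′ → t τ ≡ just e → t τ′ ≡ just e′ → τ ⊑ τ′ → τ ≡ τ′
      main-foci       : FociIn U c
      table-foci      : ∀ τ w c₀ → t τ ≡ just (w , c₀) → FociIn U c₀
      table-D-neg     : ∀ τ c₀ → t τ ≡ just (dD , c₀) → PolarityAt β τ neg
  open Invariant

  invariant-init : Invariant [] [] (initTable β)
  invariant-init = record
    { table-fresh = λ { _ _ _ _ () }
    ; table-antichain = λ τ τ′ e e′ h h′ τ⊑τ′ →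
        disjoint-⊑⇒≡ wf (proj₁ (initTable-just β τ _ _ h)) (proj₁ (initTable-just β τ′ _ _ h′)) (inj₁ τ⊑τ′)
    ; main-foci = λ _ ()
    ; table-foci = λ τ w c₀ h τ′ τ′∈ → ⊥-elim (no-foci (proj₁ (proj₂ (initTable-just β τ w c₀ h))) τ′∈)
    ; table-D-neg = λ τ c₀ h →
        inj₂ (τ , proj₂ (proj₂ (initTable-just β τ dD c₀ h)) refl , [] , sym (++-identityʳ τ) , refl)
    }
    where
    no-foci : ∀ {c₀ : List Action} {P : Action → Set} → c₀ ≡ [] → ¬ Any P c₀
    no-foci refl ()

  invariant-step : ∀ {U c t m σ I j c′} → Invariant U c t → M m (c ∷ʳ prop pos σ I) → t σ ≡ just (j , c′) →
                   Invariant (σ ∷ U) (c′ ∷ʳ prop neg σ I) (update t σ I m (c ∷ʳ prop pos σ I))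
  invariant-step {U} {c} {t} {m} {σ} {I} {j} {c′} inv σ∈M tσ = record
    { table-fresh = fresh
    ; table-antichain = antichain
    ; main-foci = FociIn-∷ʳ neg σ I (table-foci inv σ j c′ tσ)
    ; table-foci = foci
    ; table-D-neg = D-neg
    }
    where
    t′ = update t σ I m (c ∷ʳ prop pos σ I)
    fresh : ∀ τ e → t′ τ ≡ just e → ∀ u → u ∈ σ ∷ U → ¬ τ ⊑ u
    fresh τ e h u u∈ τ⊑u with update-just t σ I m _ τ e h | u∈
    ... | _ , inj₁ ((i , refl) , _) | here refl = ⊑-∷ʳ-irrefl σ i τ⊑u
    ... | _ , inj₁ ((i , refl) , _) | there u∈U = table-fresh inv σ _ tσ u u∈U (⊑-trans (u⊑u++v σ [ i ]) τ⊑u)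
    ... | τ≢σ , inj₂ tτ | here refl = τ≢σ (table-antichain inv τ σ e _ tτ tσ τ⊑u)
    ... | _ , inj₂ tτ | there u∈U = table-fresh inv τ e tτ u u∈U τ⊑u
    antichain : ∀ τ τ′ e e′ → t′ τ ≡ just e → t′ τ′ ≡ just e′ → τ ⊑ τ′ → τ ≡ τ′
    antichain τ τ′ e e′ h h′ τ⊑τ′ with update-just t σ I m _ τ e h | update-just t σ I m _ τ′ e′ h′
    ... | _ , inj₁ ((i , refl) , _) | _ , inj₁ ((i′ , refl) , _) = ∷ʳ-⊑⇒≡ σ i i′ τ⊑τ′
    ... | _ , inj₁ ((i , refl) , _) | τ′≢σ , inj₂ tτ′ =
          ⊥-elim (τ′≢σ (sym (table-antichain inv σ τ′ _ e′ tσ tτ′ (⊑-trans (u⊑u++v σ [ i ]) τ⊑τ′))))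
    ... | τ≢σ , inj₂ tτ | _ , inj₁ ((i′ , refl) , _) with ⊑-∷ʳ τ σ i′ τ⊑τ′
    ...   | inj₁ τ⊑σ = ⊥-elim (τ≢σ (table-antichain inv τ σ e _ tτ tσ τ⊑σ))
    ...   | inj₂ refl = ⊥-elim (τ≢σ (sym (table-antichain inv σ τ _ e tσ tτ (u⊑u++v σ [ i′ ]))))
    antichain τ τ′ e e′ h h′ τ⊑τ′ | _ , inj₂ tτ | _ , inj₂ tτ′ = table-antichain inv τ τ′ e e′ tτ tτ′ τ⊑τ′
    foci : ∀ τ w c₀ → t′ τ ≡ just (w , c₀) → FociIn (σ ∷ U) c₀
    foci τ w c₀ h with update-just t σ I m _ τ (w , c₀) h
    ... | _ , inj₁ (_ , refl) = FociIn-∷ʳ pos σ I (main-foci inv)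
    ... | _ , inj₂ tτ = λ τ′ τ′∈ → there (table-foci inv τ w c₀ tτ τ′ τ′∈)
    -- The children of a positive focus of D get the opposite, negative, polarity.
    D-neg : ∀ τ c₀ → t′ τ ≡ just (dD , c₀) → PolarityAt β τ neg
    D-neg τ c₀ h with update-just t σ I m _ τ (dD , c₀) h
    ... | _ , inj₁ ((i , refl) , refl) =
          polarityAt-∷ʳ i (polarityAt-focus (chronicles D _ σ∈M) c pos σ I [] refl)
    ... | _ , inj₂ tτ = table-D-neg inv τ c₀ tτ

  -- From the state (m, c, t), D goes on to play κ = (+, σ, I), answered by owner after prior.
  record Answered (U : List Locus) (m : Who n) (c : List Action) (t : Table n)
                  (p : List Action) (κ : Action) : Set₁ where
    field
      owner       : Who n
      prior       : List Action
      σ           : Locus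
      I           : List ℕ
      owner≢D     : owner ≢ dD
      answer∈     : M owner (prior ∷ʳ prop neg σ I)
      σ-unvisited : ¬ σ ∈ U
      replay      : (M′ : Who n → List Action → Set) → AgreeOutside owner (prior ∷ʳ prop neg σ I) M M′ →
                    M′ owner ((prior ∷ʳ prop neg σ I) ∷ʳ daimon) → NormPath M′ m c t (p ∷ʳ κ)

  agree-unvisited : ∀ {M′ : Who n → List Action → Set} {j c′ σ I U w d} →
                    AgreeOutside j (c′ ∷ʳ prop neg σ I) M M′ → ¬ σ ∈ U → FociIn U d → M w d → M′ w d
  agree-unvisited {d = d} agree σ∉U foci d∈ =
    agree _ d d∈ λ (_ , x⊏d) → σ∉U (foci _ (⊏-HasFocus _ _ _ d x⊏d))

  stop-at-positive : ∀ {U m c t q} → Invariant U c t → NormPath M m c t q →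
                     ∀ p κ w → q ≡ p ++ κ ∷ w → Positive κ →
                     NormPath M m c t (p ∷ʳ κ) ⊎ Answered U m c t p κ
  stop-at-positive inv (conv {m = dD} ✠∈) [] κ w refl _ = inj₁ (conv ✠∈)
  stop-at-positive inv (conv {m = dD} _) (a ∷ p) κ w eq _ = ⊥-elim (++∷≢[] p κ w (sym (∷-injectiveʳ eq)))
  stop-at-positive inv (conv {m = rPos} _) p κ w eq _ = ⊥-elim (++∷≢[] p κ w (sym eq))
  stop-at-positive inv (conv {m = rNeg _} _) p κ w eq _ = ⊥-elim (++∷≢[] p κ w (sym eq))
  stop-at-positive inv (step {m = dD} {c} {t} {σ} {I} {j} {c′} σ∈D tσ answer _) [] κ w refl _ = inj₂ record
    { owner = j ; prior = c′ ; σ = σ ; I = I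
    ; owner≢D = j≢dD
    ; answer∈ = answer
    ; σ-unvisited = λ σ∈U → table-fresh inv σ _ tσ σ σ∈U (⊑-refl σ)
    ; replay = λ M′ agree ✠∈ →
        subst (NormPath M′ dD c t) (cong (prop pos σ I ∷_) (recDaimon-opponent j j≢dD))
          (step (agree dD _ σ∈D λ (j≡dD , _) → j≢dD (sym j≡dD)) tσ
                (agree j _ answer λ (_ , x⊏x) → ⊏-irrefl _ x⊏x) (conv ✠∈))
    }
    where
    j≢dD : j ≢ dD
    j≢dD refl = polarityAt-unique β σ wf (polarityAt-focus (chronicles D _ σ∈D) c pos σ I [] refl)
                                         (table-D-neg inv σ c′ tσ)
  stop-at-positive inv (step {m = rPos} _ _ _ _) [] κ w refl ()
  stop-at-positive inv (step {m = rNeg _} _ _ _ _) [] κ w refl ()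
  stop-at-positive inv (step {m} {c} {t} {σ₁} {I₁} {j₁} {c′₁} {q′} σ₁∈ tσ₁ answer rest) (a ∷ p) κ w eq κ⁺
    with recProp-++-∷ m σ₁ I₁ q′ a (p ++ κ ∷ w) eq
  ... | rec≡a , q′≡ with stop-at-positive (invariant-step inv σ₁∈ tσ₁) rest p κ w q′≡ κ⁺
  ...   | inj₁ path = inj₁ (subst (λ r → NormPath M m c t (r ++ p ∷ʳ κ)) rec≡a (step σ₁∈ tσ₁ answer path))
  ...   | inj₂ ans = inj₂ record
    { owner = owner ; prior = prior ; σ = σ ; I = I
    ; owner≢D = owner≢D ; answer∈ = answer∈
    ; σ-unvisited = λ σ∈U → σ-unvisited (there σ∈U)
    ; replay = λ M′ agree ✠∈ →
        subst (λ r → NormPath M′ m c t (r ++ p ∷ʳ κ)) rec≡a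
          (step (agree-unvisited agree σ-unvisited (FociIn-∷ʳ pos σ₁ I₁ (main-foci inv)) σ₁∈) tσ₁
                (agree-unvisited agree σ-unvisited
                   (FociIn-∷ʳ neg σ₁ I₁ (table-foci inv σ₁ j₁ c′₁ tσ₁)) answer)
                (replay M′ agree ✠∈))
    }
    where open Answered ans

-- Normalization against a net in which the design j has been cut at x still converges:
-- until j reaches x nothing changes, and at x it now plays the daimon.
module CutConvergence {n} (M M′ : Who n → List Action → Set) (j : Who n)
                      (c′ : List Action) (σ : Locus) (I : List ℕ)
                      (agree : AgreeOutside j (c′ ∷ʳ prop neg σ I) M M′)
                      (x✠∈ : M′ j ((c′ ∷ʳ prop neg σ I) ∷ʳ daimon)) where

  private
    x = c′ ∷ʳ prop neg σ I

  record NotBeyond (m : Who n) (c : List Action) (t : Table n) : Set where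
    field
      main  : m ≡ j → x ⊑ c → c ≡ x
      table : ∀ τ c₀ → t τ ≡ just (j , c₀) → ¬ x ⊑ c₀

  notBeyond-init : ∀ m (t : Table n) → (∀ τ w c₀ → t τ ≡ just (w , c₀) → c₀ ≡ []) → NotBeyond m [] t
  notBeyond-init m t empty = record
    { main = λ _ x⊑[] → ⊥-elim (x⋢[] x⊑[])
    ; table = λ τ c₀ tτ x⊑c₀ → x⋢[] (subst (x ⊑_) (empty τ j c₀ tτ) x⊑c₀)
    }
    where
    x⋢[] : ¬ x ⊑ []
    x⋢[] (e , eq) = ∷ʳ≢[] c′ _ (++-conicalˡ x e (sym eq))

  converges : ∀ {m c t q} → NotBeyond m c t → NormPath M m c t q → ∃ λ q′ → NormPath M′ m c t q′
  converges-before : ∀ {m c t q} → (m ≡ j → ¬ x ⊑ c) → NotBeyond m c t → NormPath M m c t q →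
                     ∃ λ q′ → NormPath M′ m c t q′

  converges {m} {c} nb path with m ≟ᵂ j | ≡-dec _≟ᴬ_ c x
  ... | yes refl | yes refl = _ , conv x✠∈
  ... | yes refl | no c≢x = converges-before (λ _ x⊑c → c≢x (NotBeyond.main nb refl x⊑c)) nb path
  ... | no m≢j | _ = converges-before (λ m≡j _ → m≢j m≡j) nb path

  converges-before {c = c} before nb (conv ✠∈) =
    _ , conv (agree _ _ ✠∈ λ (m≡j , x⊏) → before m≡j (⊏-∷ʳ⇒⊑ x c daimon x⊏))
  converges-before {m} {c} {t} before nb (step {σ = σ₁} {I = I₁} {j = j₁} {c' = c′₁} σ₁∈ tσ₁ answer rest)
    with converges nb′ rest
    where
    open NotBeyond nb
    nb′ : NotBeyond j₁ (c′₁ ∷ʳ prop neg σ₁ I₁) (update t σ₁ I₁ m (c ∷ʳ prop pos σ₁ I₁))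
    nb′ = record { main = main′ ; table = table′ }
      where
      main′ : j₁ ≡ j → x ⊑ (c′₁ ∷ʳ prop neg σ₁ I₁) → c′₁ ∷ʳ prop neg σ₁ I₁ ≡ x
      main′ refl x⊑ with ⊑-∷ʳ x c′₁ _ x⊑
      ... | inj₁ x⊑c′₁ = ⊥-elim (table σ₁ c′₁ tσ₁ x⊑c′₁)
      ... | inj₂ x≡ = sym x≡
      -- x ends with a negative action, so it cannot be the positive chronicle just played.
      table′ : ∀ τ c₀ → update t σ₁ I₁ m (c ∷ʳ prop pos σ₁ I₁) τ ≡ just (j , c₀) → ¬ x ⊑ c₀
      table′ τ c₀ h x⊑c₀ with update-just t σ₁ I₁ m _ τ (j , c₀) h
      ... | _ , inj₂ tτ = table τ c₀ tτ x⊑c₀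
      ... | _ , inj₁ (_ , refl) with ⊑-∷ʳ x c _ x⊑c₀
      ...   | inj₁ x⊑c = before refl x⊑c
      ...   | inj₂ x≡ with ∷ʳ-injectiveʳ c′ c x≡
      ...     | ()
  ... | _ , path′ =
        _ , step (agree _ _ σ₁∈ λ (m≡j , x⊏) → before m≡j (⊏-∷ʳ⇒⊑ x c _ x⊏)) tσ₁
                 (agree _ _ answer λ { (refl , x⊏) → NotBeyond.table nb σ₁ c′₁ tσ₁ (⊏-∷ʳ⇒⊑ x c′₁ _ x⊏) })
                 path′

record NetCut {β : Base} (R : Net β) (j : Who (length (right β))) (x : List Action) : Set₁ where
  field
    net       : Net β
    agree     : ∀ D → AgreeOutside j x (memW D R) (memW D net)
    daimon-at : ∀ D → memW D net j (x ∷ʳ daimon)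

module _ {l : Maybe Locus} {Λ : List Locus} (R : Net (base l Λ)) (i : Fin (length Λ))
         (D′ : Design (base (just (lookup Λ i)) [])) where

  replaceNeg : (i′ : Fin (length Λ)) → Design (base (just (lookup Λ i′)) [])
  replaceNeg i′ with i′ ≟ᶠ i
  ... | yes refl = D′
  ... | no _ = negPart R i′

  replaceNeg-≡ : replaceNeg i ≡ D′
  replaceNeg-≡ with i ≟ᶠ i
  ... | yes refl = refl
  ... | no i≢i = ⊥-elim (i≢i refl)

  replaceNeg-≢ : ∀ i′ → i′ ≢ i → replaceNeg i′ ≡ negPart R i′
  replaceNeg-≢ i′ i′≢i with i′ ≟ᶠ i
  ... | yes refl = ⊥-elim (i′≢i refl)
  ... | no _ = refl

cutNet : ∀ {l Λ} (R : Net (base l Λ)) (D : Design (base l Λ)) j c σ I → j ≢ dD →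
         memW D R j (c ∷ʳ prop neg σ I) → NetCut R j (c ∷ʳ prop neg σ I)
cutNet R D dD c σ I j≢dD _ = ⊥-elim (j≢dD refl)
cutNet {nothing} R D rPos c σ I _ ()
cutNet {just ξ} R D rPos c σ I _ x∈ = record
  { net = record { posPart = truncated ; negPart = negPart R }
  ; agree = agree
  ; daimon-at = λ _ → inj₂ refl
  }
  where
  open Truncation (posPart R) c σ I x∈
  agree : ∀ D → AgreeOutside rPos x (memW D R) (memW D _)
  agree D dD d d∈ _ = d∈
  agree D rPos d d∈ outside = inj₁ (d∈ , λ x⊏d → outside (refl , x⊏d))
  agree D (rNeg _) d d∈ _ = d∈
cutNet {l} {Λ} R D (rNeg i) c σ I _ x∈ = record
  { net = record { posPart = posPart R ; negPart = replaceNeg R i truncated }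
  ; agree = agree
  ; daimon-at = λ _ → subst (λ D′ → mem D′ _) (sym (replaceNeg-≡ R i truncated)) (inj₂ refl)
  }
  where
  open Truncation (negPart R i) c σ I x∈
  agree : ∀ D → AgreeOutside (rNeg i) x (memW D R) (memW D _)
  agree D dD d d∈ _ = d∈
  agree D rPos d d∈ _ = d∈
  agree D (rNeg i′) d d∈ outside with i′ ≟ᶠ i
  ... | yes refl = subst (λ D′ → mem D′ d) (sym (replaceNeg-≡ R i truncated))
                         (inj₁ (d∈ , λ x⊏d → outside (refl , x⊏d)))
  ... | no i′≢i = subst (λ D′ → mem D′ d) (sym (replaceNeg-≢ R i truncated i′ i′≢i)) d∈

cutNet-perp : ∀ {β} {E : Design β → Set} {R : Net β} {j c σ I} → Perp E R →
              (C : NetCut R j (c ∷ʳ prop neg σ I)) → Perp E (NetCut.net C)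
cutNet-perp {β} {j = j} {c} {σ} {I} R⊥E C D D∈E =
  converges (notBeyond-init (initMain β) (initTable β) λ τ w c₀ h → proj₁ (proj₂ (initTable-just β τ w c₀ h)))
            (proj₂ (R⊥E D D∈E))
  where
  open NetCut C
  open CutConvergence (memW D _) (memW D net) j c σ I (agree D) (daimon-at D)

corollary4p12 : (β : Base) → WFBase β → (E : Design β → Set) →
                (p : List Action) (κ : Action) (w : List Action) →
                Positive κ → Visitable E (p ++ κ ∷ w) → Visitable E (p ∷ʳ κ)
corollary4p12 β wf E p κ w κ⁺ (D , D∈E , R , R⊥E , path)
  with Visit.stop-at-positive wf D R (Visit.invariant-init wf D R) path p κ w refl κ⁺
... | inj₁ path′ = D , D∈E , R , R⊥E , path′
... | inj₂ ans = D , D∈E , net , cutNet-perp R⊥E C , replay (memW D net) (agree D) (daimon-at D)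
  where
  open Visit.Answered ans
  C = cutNet R D owner prior σ I owner≢D answer∈
  open NetCut C
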